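{- Let $G=([n],E)$ be a $2$-connected finite simple graph, let $i,j$ be distinct vertices, and let $\gamma$ be a shortest path in $G$ from $i$ to $j$. Let $<$ be a total order on $E$ in which every edge of $\gamma$ is smaller than every edge not in $\gamma$, and let $\Gamma$ be the HJM triangulation of $P_G$ induced by $<$. Then for every choice of orientations of the edges of $\gamma$, the set of vertices of $P_G$ corresponding to these oriented edges spans a face of $\Gamma$.
   Context: A graph is $2$-connected if it has at least $3$ vertices, is connected and has no cut vertex. $P_G:=\operatorname{conv}\{\pm(e_k-e_l):\{k,l\}\in E\}\subseteq\mathbb{R}^n$; its lattice points are the origin and its vertices, and the vertex $e_l-e_k$ corresponds to the oriented edge $k\to l$. HJM triangulation: fix a field $K$; for each edge $e$ let $x_e,y_e$ be variables for the two vertices of $P_G$ corresponding to the two orientations of $e$ (one chosen as $x_e$), and $z$ the variable for the origin. Let $I_{P_G}\subseteq K[z,x_e,y_e:e\in E]$ be the toric ideal of the lattice points of $P_G$ (the kernel of the map sending the variable of a lattice point $\alpha$ to $\mathbf{t}^{\alpha}s$ in $K[t_1^{\pm1},\dots,t_n^{\pm1},s]$). If $e_1<\dots<e_m$ is the order on $E$, order the variables $z<x_{e_1}<y_{e_1}<\dots<x_{e_m}<y_{e_m}$ and use the degree reverse lexicographic order. The HJM triangulation is the triangulation of $P_G$ whose faces are the simplices $\operatorname{conv}(S)$ for sets $S$ of lattice points with $\prod_{\alpha\in S}x_\alpha\notin\operatorname{in}(I_{P_G})$. -}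

module Defs where

open import Level using (Level; _⊔_)
open import Algebra.Bundles using (CommutativeRing)
open import Data.Nat as ℕ using (ℕ; zero; suc; _≤_; _<_)
open import Data.Integer as ℤ using (ℤ; +_; 0ℤ; 1ℤ)
open import Data.Fin as Fin using (Fin; zero; suc; inject₁; fromℕ; toℕ)
open import Data.Fin.Properties using (all?)
open import Data.Product using (Σ; ∃; ∃-syntax; _×_; _,_; proj₁; proj₂)
open import Data.Sum using (_⊎_; inj₁; inj₂)
open import Data.List using (List; []; _∷_)
open import Relation.Binary.PropositionalEquality using (_≡_; _≢_; refl; cong)
open import Relation.Nullary using (¬_; Dec; yes; no)
open import Relation.Nullary.Decidable using (map′; _×-dec_)

record Field (c ℓ : Level) : Set (Level.suc (c ⊔ ℓ)) where
  field
    commutativeRing : CommutativeRing c ℓ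
  open CommutativeRing commutativeRing public
  field
    1≉0     : ¬ (1# ≈ 0#)
    inverse : ∀ a → ¬ (a ≈ 0#) → ∃[ b ] (a * b ≈ 1#)

-- Graphs on vertex set [n] = Fin n with m edges e_0 < e_1 < ... < e_{m-1}
-- (the total order on E is the order of the indices).  Edge k is given
-- as an ordered pair  ends k = (a , b);  the variable x_{e_k} is the one
-- for the oriented edge a → b (lattice point e_b - e_a) and y_{e_k} the
-- one for b → a (lattice point e_a - e_b).

Edges : ℕ → ℕ → Set
Edges n m = Fin m → Fin n × Fin n

module _ {n m : ℕ} (ends : Edges n m) where

  Joins : Fin m → Fin n → Fin n → Set
  Joins k a b = ends k ≡ (a , b) ⊎ ends k ≡ (b , a)

  SimpleGraph : Set
  SimpleGraph = (∀ k → proj₁ (ends k) ≢ proj₂ (ends k))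
              × (∀ k k' → Joins k' (proj₁ (ends k)) (proj₂ (ends k)) → k ≡ k')

  Adj : Fin n → Fin n → Set
  Adj a b = ∃[ k ] Joins k a b

  IsWalk : (L : ℕ) → (Fin (suc L) → Fin n) → Set
  IsWalk L p = ∀ (t : Fin L) → Adj (p (inject₁ t)) (p (suc t))

  WalkFromTo : Fin n → Fin n → (L : ℕ) → (Fin (suc L) → Fin n) → Set
  WalkFromTo a b L p = IsWalk L p × p zero ≡ a × p (fromℕ L) ≡ b

  PathFromTo : Fin n → Fin n → (L : ℕ) → (Fin (suc L) → Fin n) → Set
  PathFromTo a b L p = WalkFromTo a b L p × (∀ s t → p s ≡ p t → s ≡ t)

  Connected : Set
  Connected = ∀ a b → ∃[ L ] ∃[ p ] WalkFromTo a b L p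

  NoCutVertex : Set
  NoCutVertex = ∀ c a b → a ≢ c → b ≢ c →
    ∃[ L ] ∃[ p ] (WalkFromTo a b L p × (∀ t → p t ≢ c))

  TwoConnected : Set
  TwoConnected = 3 ≤ n × Connected × NoCutVertex

  ShortestPath : Fin n → Fin n → (L : ℕ) → (Fin (suc L) → Fin n) → Set
  ShortestPath a b L p = PathFromTo a b L p
    × (∀ L' p' → PathFromTo a b L' p' → L ≤ L')

  OnPath : (L : ℕ) → (Fin (suc L) → Fin n) → Fin m → Set
  OnPath L p k = ∃[ t ] Joins k (p (inject₁ t)) (p (suc t))

-- Variables of the polynomial ring K[z, x_e, y_e : e ∈ E], with the
-- variable order z < x_{e_0} < y_{e_0} < x_{e_1} < ... (given by rank).

data Var (m : ℕ) : Set where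
  z : Var m
  x : Fin m → Var m
  y : Fin m → Var m

rank : ∀ {m} → Var m → ℕ
rank z     = 0
rank (x k) = 1 ℕ.+ 2 ℕ.* toℕ k
rank (y k) = 2 ℕ.+ 2 ℕ.* toℕ k

δ : ∀ {n} → Fin n → Fin n → ℤ
δ s t with s Fin.≟ t
... | yes _ = 1ℤ
... | no  _ = 0ℤ

point : ∀ {n m} → Edges n m → Var m → Fin n → ℤ
point ends z     t = 0ℤ
point ends (x k) t = δ t (proj₂ (ends k)) ℤ.- δ t (proj₁ (ends k))
point ends (y k) t = δ t (proj₁ (ends k)) ℤ.- δ t (proj₂ (ends k))

sumFinℕ : ∀ m → (Fin m → ℕ) → ℕ
sumFinℕ zero    f = 0
sumFinℕ (suc m) f = f zero ℕ.+ sumFinℕ m (λ k → f (suc k))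

sumFinℤ : ∀ m → (Fin m → ℤ) → ℤ
sumFinℤ zero    f = 0ℤ
sumFinℤ (suc m) f = f zero ℤ.+ sumFinℤ m (λ k → f (suc k))

sumVarℕ : ∀ {m} → (Var m → ℕ) → ℕ
sumVarℕ {m} f = f z ℕ.+ sumFinℕ m (λ k → f (x k) ℕ.+ f (y k))

sumVarℤ : ∀ {m} → (Var m → ℤ) → ℤ
sumVarℤ {m} f = f z ℤ.+ sumFinℤ m (λ k → f (x k) ℤ.+ f (y k))

Exp : ℕ → Set
Exp m = Var m → ℕ

deg : ∀ {m} → Exp m → ℕ
deg u = sumVarℕ u

-- image of the monomial x^u under  x_α ↦ t^α s :  t^(image u) s^(deg u)
image : ∀ {n m} → Edges n m → Exp m → Fin n → ℤ
image ends u t = sumVarℤ (λ v → + (u v) ℤ.* point ends v t)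

_≐_ : ∀ {m} → Exp m → Exp m → Set
u ≐ w = ∀ v → u v ≡ w v

_≐?_ : ∀ {m} (u w : Exp m) → Dec (u ≐ w)
u ≐? w = map′ to from
  ((u z ℕ.≟ w z) ×-dec (all? (λ k → u (x k) ℕ.≟ w (x k)) ×-dec all? (λ k → u (y k) ℕ.≟ w (y k))))
  where
  to : _ → u ≐ w
  to (e , _ , _) z     = e
  to (_ , ex , _) (x k) = ex k
  to (_ , _ , ey) (y k) = ey k
  from : u ≐ w → _
  from e = e z , (λ k → e (x k)) , (λ k → e (y k))

_≗ℤ?_ : ∀ {n} (a b : Fin n → ℤ) → Dec (∀ t → a t ≡ b t)
a ≗ℤ? b = all? (λ t → a t ℤ.≟ b t)

-- degree reverse lexicographic order: w ≺ u means x^w < x^u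
_≺_ : ∀ {m} → Exp m → Exp m → Set
w ≺ u = deg w < deg u
      ⊎ (deg w ≡ deg u × ∃[ v ] (u v < w v × (∀ v' → rank v' < rank v → u v' ≡ w v')))

module Poly {c ℓ} (K : Field c ℓ) where
  open Field K

  Polynomial : ℕ → Set c
  Polynomial m = List (Carrier × Exp m)

  coeff : ∀ {m} → Polynomial m → Exp m → Carrier
  coeff []             w = 0#
  coeff ((a , u) ∷ f) w with u ≐? w
  ... | yes _ = a + coeff f w
  ... | no  _ = coeff f w

  imageCoeff : ∀ {n m} → Edges n m → Polynomial m → (Fin n → ℤ) → ℕ → Carrier
  imageCoeff ends []             α d = 0#
  imageCoeff ends ((a , u) ∷ f) α d with image ends u ≗ℤ? α | deg u ℕ.≟ d
  ... | yes _ | yes _ = a + imageCoeff ends f α d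
  ... | _     | _     = imageCoeff ends f α d

  -- f ∈ I_{P_G}: f lies in the kernel of x_α ↦ t^α s
  InToricIdeal : ∀ {n m} → Edges n m → Polynomial m → Set ℓ
  InToricIdeal ends f = ∀ α d → imageCoeff ends f α d ≈ 0#

  IsLeading : ∀ {m} → Polynomial m → Exp m → Set ℓ
  IsLeading f w = ¬ (coeff f w ≈ 0#)
    × (∀ w' → ¬ (coeff f w' ≈ 0#) → w' ≐ w ⊎ w' ≺ w)

  -- x^u ∈ in(I_{P_G}) = ⟨ in(f) : f ∈ I_{P_G} ⟩, i.e. x^u is divisible by
  -- the leading monomial of some nonzero f ∈ I_{P_G}
  InInitialIdeal : ∀ {n m} → Edges n m → Exp m → Set (c ⊔ ℓ)
  InInitialIdeal ends u = ∃[ f ] (InToricIdeal ends f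
    × ∃[ w ] (IsLeading f w × (∀ v → w v ≤ u v)))

_≟V_ : ∀ {m} (v w : Var m) → Dec (v ≡ w)
z   ≟V z    = yes refl
z   ≟V x _  = no λ ()
z   ≟V y _  = no λ ()
x _ ≟V z    = no λ ()
x k ≟V x l with k Fin.≟ l
... | yes refl = yes refl
... | no  k≢l  = no λ { refl → k≢l refl }
x _ ≟V y _  = no λ ()
y _ ≟V z    = no λ ()
y _ ≟V x _  = no λ ()
y k ≟V y l with k Fin.≟ l
... | yes refl = yes refl
... | no  k≢l  = no λ { refl → k≢l refl }

IsOrientation : ∀ {n m} → Edges n m → (L : ℕ) → (Fin (suc L) → Fin n) →
  (Fin L → Var m) → Set
IsOrientation ends L p σ = ∀ t → ∃[ k ]
  ((σ t ≡ x k ⊎ σ t ≡ y k) × Joins ends k (p (inject₁ t)) (p (suc t)))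

monomialOf : ∀ {m} (L : ℕ) → (Fin L → Var m) → Exp m
monomialOf L σ v = sumFinℕ L (λ t → indicator (σ t ≟V v))
  where
  indicator : ∀ {p} {P : Set p} → Dec P → ℕ
  indicator (yes _) = 1
  indicator (no _)  = 0

-- the set of lattice points with variables σ t spans a face of the HJM
-- triangulation: ∏_t x_{σ t} ∉ in(I_{P_G})
SpansFace : ∀ {c ℓ} (K : Field c ℓ) {n m} → Edges n m → (L : ℕ) → (Fin L → Var m) → Set (c ⊔ ℓ)
SpansFace K ends L σ = ¬ Poly.InInitialIdeal K ends (monomialOf L σ)

-- It suffices that every monomial w dividing the path monomial U is the degrevlex-least
-- monomial of its fibre: then no leading monomial of an element of I_{P_G} divides U.
-- Suppose u ≺ w lie in one fibre and revlex decides at v₀, so w v₀ < u v₀.  A potential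
-- ψ : [n] → ℕ that changes by at most one along edges gives each variable v the slack
-- 1 − ⟨ψ, point v⟩ ≥ 0, and the slack-weighted degree is constant on fibres.  Hence if the
-- slack vanishes wherever w exceeds u, it also vanishes wherever u exceeds w, e.g. at v₀.
-- If v₀ belongs to an edge off γ, every variable where w exceeds u is a path variable,
-- smaller than v₀, where u and w agree; so there are none and the zero potential works.
-- Otherwise let ψ rise by one along σ t on the path edges t with u (σ t) < w (σ t), stay
-- level on the other path edges, and extend it to G by ψ c = min_t (ψ (γ t) + d(γ t, c)).
-- As γ is a shortest path this extension keeps the prescribed values, and v₀ (z, or an
-- orientation of a path edge other than the tight one) gets positive slack.
module Submission where

open import Defs
open import Data.Bool using (Bool; true; false; _∧_; not; if_then_else_)
open import Data.Bool.Properties using (∧-zeroʳ)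
open import Data.Nat as ℕ using (ℕ; zero; suc; _≤_; _<_; ∣_-_∣)
import Data.Nat.Properties as ℕP
open import Data.Integer as ℤ using (ℤ)
import Data.Integer.Properties as ℤP
open import Data.Fin as Fin using (Fin; zero; suc; toℕ; fromℕ; inject₁)
import Data.Fin.Properties as FinP
open import Data.Product using (∃-syntax; Σ; _×_; _,_; proj₁; proj₂)
open import Data.Product.Properties using (≡-dec)
open import Data.Sum as Sum using (_⊎_; inj₁; inj₂)
open import Data.List using ([]; _∷_)
open import Data.Unit using (⊤; tt)
open import Data.Empty using (⊥; ⊥-elim)
open import Function using (_∘_)
open import Relation.Binary.PropositionalEquality as ≡ using (_≡_; _≢_; _≗_; refl; cong; cong₂)
open import Relation.Nullary using (¬_; Dec; yes; no)
open import Relation.Nullary.Decidable using (⌊_⌋; map′; _×-dec_; _⊎-dec_)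
open import Relation.Nullary.Negation using (¬¬-Monad)
open import Effect.Monad using (RawMonad)
import Algebra.Properties.Semiring.Sum as SemiringSum
import Algebra.Properties.CommutativeSemigroup as CommSemigroupProperties

-- Finite sums

module ℕΣ = SemiringSum ℕP.+-*-semiring
module ℤΣ = SemiringSum ℤP.+-*-semiring
open CommSemigroupProperties ℕP.+-commutativeSemigroup using () renaming (interchange to ℕ-interchange)
open CommSemigroupProperties ℤP.+-commutativeSemigroup using () renaming (interchange to ℤ-interchange)

sumFinℕ≡∑ : ∀ m (f : Fin m → ℕ) → sumFinℕ m f ≡ ℕΣ.sum f
sumFinℕ≡∑ zero    f = refl
sumFinℕ≡∑ (suc m) f = cong (ℕ._+_ (f zero)) (sumFinℕ≡∑ m (f ∘ suc))

sumFinℤ≡∑ : ∀ m (f : Fin m → ℤ) → sumFinℤ m f ≡ ℤΣ.sum f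
sumFinℤ≡∑ zero    f = refl
sumFinℤ≡∑ (suc m) f = cong (ℤ._+_ (f zero)) (sumFinℤ≡∑ m (f ∘ suc))

sumFinℕ-cong : ∀ m {f g : Fin m → ℕ} → f ≗ g → sumFinℕ m f ≡ sumFinℕ m g
sumFinℕ-cong zero    f≗g = refl
sumFinℕ-cong (suc m) f≗g = cong₂ ℕ._+_ (f≗g zero) (sumFinℕ-cong m (f≗g ∘ suc))

sumFinℤ-cong : ∀ m {f g : Fin m → ℤ} → f ≗ g → sumFinℤ m f ≡ sumFinℤ m g
sumFinℤ-cong zero    f≗g = refl
sumFinℤ-cong (suc m) f≗g = cong₂ ℤ._+_ (f≗g zero) (sumFinℤ-cong m (f≗g ∘ suc))

sumFinℕ-distrib-+ : ∀ m (f g : Fin m → ℕ) →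
  sumFinℕ m (λ k → f k ℕ.+ g k) ≡ sumFinℕ m f ℕ.+ sumFinℕ m g
sumFinℕ-distrib-+ m f g = ≡.trans (sumFinℕ≡∑ m _)
  (≡.trans (ℕΣ.∑-distrib-+ f g) (≡.sym (cong₂ ℕ._+_ (sumFinℕ≡∑ m f) (sumFinℕ≡∑ m g))))

sumFinℤ-distrib-+ : ∀ m (f g : Fin m → ℤ) →
  sumFinℤ m (λ k → f k ℤ.+ g k) ≡ sumFinℤ m f ℤ.+ sumFinℤ m g
sumFinℤ-distrib-+ m f g = ≡.trans (sumFinℤ≡∑ m _)
  (≡.trans (ℤΣ.∑-distrib-+ f g) (≡.sym (cong₂ ℤ._+_ (sumFinℤ≡∑ m f) (sumFinℤ≡∑ m g))))

*-distribˡ-sumFinℤ : ∀ m a (f : Fin m → ℤ) → a ℤ.* sumFinℤ m f ≡ sumFinℤ m (λ k → a ℤ.* f k)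
*-distribˡ-sumFinℤ m a f = ≡.trans (cong (a ℤ.*_) (sumFinℤ≡∑ m f))
  (≡.trans (ℤΣ.*-distribˡ-sum a f) (≡.sym (sumFinℤ≡∑ m _)))

sumFinℤ-comm : ∀ m n (F : Fin m → Fin n → ℤ) →
  sumFinℤ m (λ k → sumFinℤ n (F k)) ≡ sumFinℤ n (λ t → sumFinℤ m (λ k → F k t))
sumFinℤ-comm m n F = begin
  sumFinℤ m (λ k → sumFinℤ n (F k))         ≡⟨ sumFinℤ-cong m (λ k → sumFinℤ≡∑ n (F k)) ⟩
  sumFinℤ m (λ k → ℤΣ.sum (F k))            ≡⟨ sumFinℤ≡∑ m _ ⟩
  ℤΣ.sum (λ k → ℤΣ.sum (F k))               ≡⟨ ℤΣ.∑-comm F ⟩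
  ℤΣ.sum (λ t → ℤΣ.sum (λ k → F k t))       ≡⟨ sumFinℤ≡∑ n _ ⟨
  sumFinℤ n (λ t → ℤΣ.sum (λ k → F k t))    ≡⟨ sumFinℤ-cong n (λ t → sumFinℤ≡∑ m (λ k → F k t)) ⟨
  sumFinℤ n (λ t → sumFinℤ m (λ k → F k t)) ∎
  where open ≡.≡-Reasoning

sumFinℤ-zero : ∀ m → sumFinℤ m (λ _ → ℤ.0ℤ) ≡ ℤ.0ℤ
sumFinℤ-zero zero    = refl
sumFinℤ-zero (suc m) = ≡.trans (ℤP.+-identityˡ _) (sumFinℤ-zero m)

sumFinℤ-single : ∀ m (g : Fin m → ℤ) b → (∀ k → k ≢ b → g k ≡ ℤ.0ℤ) → sumFinℤ m g ≡ g b
sumFinℤ-single (suc m) g zero    g≡0 = ≡.trans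
  (cong (ℤ._+_ (g zero)) (≡.trans (sumFinℤ-cong m λ k → g≡0 (suc k) λ ()) (sumFinℤ-zero m)))
  (ℤP.+-identityʳ (g zero))
sumFinℤ-single (suc m) g (suc b) g≡0 = ≡.trans
  (cong₂ ℤ._+_ (g≡0 zero λ ())
    (sumFinℤ-single m (g ∘ suc) b λ k k≢b → g≡0 (suc k) (k≢b ∘ FinP.suc-injective)))
  (ℤP.+-identityˡ (g (suc b)))

+-sumFinℕ : ∀ m (f : Fin m → ℕ) → ℤ.+ sumFinℕ m f ≡ sumFinℤ m (λ k → ℤ.+ f k)
+-sumFinℕ zero    f = refl
+-sumFinℕ (suc m) f =
  ≡.trans (ℤP.pos-+ (f zero) _) (cong (ℤ._+_ (ℤ.+ f zero)) (+-sumFinℕ m (f ∘ suc)))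

term≤sumFinℕ : ∀ m (f : Fin m → ℕ) k → f k ≤ sumFinℕ m f
term≤sumFinℕ (suc m) f zero    = ℕP.m≤m+n _ _
term≤sumFinℕ (suc m) f (suc k) = ℕP.≤-trans (term≤sumFinℕ m (f ∘ suc) k) (ℕP.m≤n+m _ _)

sumFinℕ-zero : ∀ m (f : Fin m → ℕ) → (∀ k → f k ≡ 0) → sumFinℕ m f ≡ 0
sumFinℕ-zero zero    f f≡0 = refl
sumFinℕ-zero (suc m) f f≡0 = cong₂ ℕ._+_ (f≡0 zero) (sumFinℕ-zero m (f ∘ suc) (f≡0 ∘ suc))

module _ {m : ℕ} where

  sumVarℕ-cong : {f g : Var m → ℕ} → f ≗ g → sumVarℕ f ≡ sumVarℕ g
  sumVarℕ-cong f≗g = cong₂ ℕ._+_ (f≗g z) (sumFinℕ-cong m λ k → cong₂ ℕ._+_ (f≗g (x k)) (f≗g (y k)))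

  sumVarℤ-cong : {f g : Var m → ℤ} → f ≗ g → sumVarℤ f ≡ sumVarℤ g
  sumVarℤ-cong f≗g = cong₂ ℤ._+_ (f≗g z) (sumFinℤ-cong m λ k → cong₂ ℤ._+_ (f≗g (x k)) (f≗g (y k)))

  sumVarℕ-distrib-+ : (f g : Var m → ℕ) → sumVarℕ (λ v → f v ℕ.+ g v) ≡ sumVarℕ f ℕ.+ sumVarℕ g
  sumVarℕ-distrib-+ f g = ≡.trans
    (cong (ℕ._+_ (f z ℕ.+ g z))
      (≡.trans (sumFinℕ-cong m λ k → ℕ-interchange (f (x k)) (g (x k)) (f (y k)) (g (y k)))
               (sumFinℕ-distrib-+ m _ _)))
    (ℕ-interchange (f z) (g z) _ _)

  sumVarℤ-distrib-+ : (f g : Var m → ℤ) → sumVarℤ (λ v → f v ℤ.+ g v) ≡ sumVarℤ f ℤ.+ sumVarℤ g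
  sumVarℤ-distrib-+ f g = ≡.trans
    (cong (ℤ._+_ (f z ℤ.+ g z))
      (≡.trans (sumFinℤ-cong m λ k → ℤ-interchange (f (x k)) (g (x k)) (f (y k)) (g (y k)))
               (sumFinℤ-distrib-+ m _ _)))
    (ℤ-interchange (f z) (g z) _ _)

  *-distribˡ-sumVarℤ : ∀ a (f : Var m → ℤ) → a ℤ.* sumVarℤ f ≡ sumVarℤ (λ v → a ℤ.* f v)
  *-distribˡ-sumVarℤ a f = ≡.trans (ℤP.*-distribˡ-+ a (f z) _)
    (cong (ℤ._+_ (a ℤ.* f z)) (≡.trans (*-distribˡ-sumFinℤ m a _)
      (sumFinℤ-cong m λ k → ℤP.*-distribˡ-+ a (f (x k)) (f (y k)))))

  sumFinℤ-sumVarℤ-comm : ∀ n (F : Var m → Fin n → ℤ) →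
    sumFinℤ n (λ t → sumVarℤ (λ v → F v t)) ≡ sumVarℤ (λ v → sumFinℤ n (F v))
  sumFinℤ-sumVarℤ-comm n F = ≡.trans (sumFinℤ-distrib-+ n _ _) (cong (ℤ._+_ (sumFinℤ n (F z)))
    (≡.trans (≡.sym (sumFinℤ-comm m n _)) (sumFinℤ-cong m λ k → sumFinℤ-distrib-+ n _ _)))

  +-sumVarℕ : (f : Var m → ℕ) → ℤ.+ sumVarℕ f ≡ sumVarℤ (λ v → ℤ.+ f v)
  +-sumVarℕ f = ≡.trans (ℤP.pos-+ (f z) _) (cong (ℤ._+_ (ℤ.+ f z))
    (≡.trans (+-sumFinℕ m _) (sumFinℤ-cong m λ k → ℤP.pos-+ (f (x k)) (f (y k)))))

  term≤sumVarℕ : (f : Var m → ℕ) (v : Var m) → f v ≤ sumVarℕ f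
  term≤sumVarℕ f z     = ℕP.m≤m+n _ _
  term≤sumVarℕ f (x k) = ℕP.≤-trans (ℕP.≤-trans (ℕP.m≤m+n _ _) (term≤sumFinℕ m _ k)) (ℕP.m≤n+m _ _)
  term≤sumVarℕ f (y k) = ℕP.≤-trans (ℕP.≤-trans (ℕP.m≤n+m _ _) (term≤sumFinℕ m _ k)) (ℕP.m≤n+m _ _)

  sumVarℕ-zero : (f : Var m → ℕ) → (∀ v → f v ≡ 0) → sumVarℕ f ≡ 0
  sumVarℕ-zero f f≡0 = cong₂ ℕ._+_ (f≡0 z) (sumFinℕ-zero m _ λ k → cong₂ ℕ._+_ (f≡0 (x k)) (f≡0 (y k)))

m≤n+o∧n≤m+o⇒∣m-n∣≤o : ∀ m n {o} → m ≤ n ℕ.+ o → n ≤ m ℕ.+ o → ∣ m - n ∣ ≤ o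
m≤n+o∧n≤m+o⇒∣m-n∣≤o m n m≤n+o n≤m+o with ℕP.∣m-n∣≡[m∸n]∨[n∸m] m n
... | inj₁ eq = ≡.subst (_≤ _) (≡.sym eq) (ℕP.m≤n+o⇒m∸n≤o m n m≤n+o)
... | inj₂ eq = ≡.subst (_≤ _) (≡.sym eq) (ℕP.m≤n+o⇒m∸n≤o n m n≤m+o)

least : ∀ {p} {P : ℕ → Set p} → (∀ h → Dec (P h)) → ∀ {N} → P N →
  ∃[ h ] (P h × (∀ {h'} → P h' → h ≤ h'))
least P? {zero}  P0 = 0 , P0 , λ _ → ℕ.z≤n
least {P = P} P? {suc N} PN with P? 0
... | yes P0 = 0 , P0 , λ _ → ℕ.z≤n
... | no ¬P0 with least (P? ∘ suc) PN
...   | h , Ph , minimal = suc h , Ph , above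
  where
  above : ∀ {h'} → P h' → suc h ≤ h'
  above {zero}   P0  = ⊥-elim (¬P0 P0)
  above {suc h'} Ph' = ℕ.s≤s (minimal Ph')

-- Monomials, fibres and the initial ideal

_∣ₘ_ : ∀ {m} → Exp m → Exp m → Set
u ∣ₘ w = ∀ v → u v ≤ w v

_⊓ₑ_ _∸ₑ_ : ∀ {m} → Exp m → Exp m → Exp m
(u ⊓ₑ w) v = u v ℕ.⊓ w v
(u ∸ₑ w) v = u v ℕ.∸ w v

SameFiber : ∀ {n m} → Edges n m → Exp m → Exp m → Set
SameFiber ends u w = (∀ t → image ends u t ≡ image ends w t) × deg u ≡ deg w

image-cong : ∀ {n m} (ends : Edges n m) {u w : Exp m} → u ≐ w → ∀ t → image ends u t ≡ image ends w t
image-cong ends u≐w t = sumVarℤ-cong λ v → cong (λ e → ℤ.+ e ℤ.* point ends v t) (u≐w v)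

deg-cong : ∀ {m} {u w : Exp m} → u ≐ w → deg u ≡ deg w
deg-cong = sumVarℕ-cong

monomialOf-support : ∀ {m} L (σ : Fin L → Var m) v → 0 < monomialOf L σ v → ∃[ t ] σ t ≡ v
monomialOf-support (suc L) σ v pos with σ zero ≟V v
... | yes σ₀≡v = zero , σ₀≡v
... | no _     = let t , σₜ≡v = monomialOf-support L (σ ∘ suc) v pos in suc t , σₜ≡v

IsVarOf : ∀ {m} → Var m → Fin m → Set
IsVarOf v k = v ≡ x k ⊎ v ≡ y k

rank-below : ∀ {m} {v : Var m} {k} → IsVarOf v k → rank v ≤ 2 ℕ.+ 2 ℕ.* toℕ k
rank-below (inj₁ refl) = ℕP.n≤1+n _
rank-below (inj₂ refl) = ℕP.≤-refl

rank-above : ∀ {m} {v : Var m} {k} → IsVarOf v k → 2 ℕ.* toℕ k < rank v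
rank-above (inj₁ refl) = ℕP.≤-refl
rank-above (inj₂ refl) = ℕP.n≤1+n _

rank-mono : ∀ {m} {v v' : Var m} {k k'} → k Fin.< k' → IsVarOf v k → IsVarOf v' k' → rank v < rank v'
rank-mono {k = k} {k'} k<k' isVar isVar' =
  ℕP.≤-<-trans (rank-below isVar) (ℕP.≤-<-trans twice (rank-above isVar'))
  where
  twice : 2 ℕ.+ 2 ℕ.* toℕ k ≤ 2 ℕ.* toℕ k'
  twice = ℕP.≤-trans (ℕP.≤-reflexive (≡.sym (ℕP.*-suc 2 (toℕ k)))) (ℕP.*-monoʳ-≤ 2 k<k')

⌊⌋-cong : ∀ {a b} {A : Set a} {B : Set b} → (A → B) → (B → A) →
  (a? : Dec A) (b? : Dec B) → ⌊ a? ⌋ ≡ ⌊ b? ⌋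
⌊⌋-cong _ _ (yes _) (yes _) = refl
⌊⌋-cong _ _ (no _)  (no _)  = refl
⌊⌋-cong f _ (yes a) (no ¬b) = ⊥-elim (¬b (f a))
⌊⌋-cong _ g (no ¬a) (yes b) = ⊥-elim (¬a (g b))

module InitialIdeal {c ℓ} (K : Field c ℓ) where
  open Field K renaming (refl to ≈-refl)
  open Poly K
  open import Relation.Binary.Reasoning.Setoid setoid
  open RawMonad (¬¬-Monad {ℓ}) using (pure; _<$>_; _⊗_)
  open import Algebra.Properties.CommutativeSemigroup +-commutativeSemigroup using (x∙yz≈y∙xz)

  Respects≐ : ∀ {m} → (Exp m → Bool) → Set
  Respects≐ P = ∀ {u w} → u ≐ w → P u ≡ P w

  sumCoeffs : ∀ {m} → (Exp m → Bool) → Polynomial m → Carrier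
  sumCoeffs P []             = 0#
  sumCoeffs P ((a , u) ∷ f) = if P u then a + sumCoeffs P f else sumCoeffs P f

  _∖_ : ∀ {m} → (Exp m → Bool) → Exp m → Exp m → Bool
  (P ∖ w) u = P u ∧ not ⌊ u ≐? w ⌋

  ∖-respects : ∀ {m} {P : Exp m → Bool} w → Respects≐ P → Respects≐ (P ∖ w)
  ∖-respects {P = P} w resp {u} {u'} u≐u' with u ≐? w | u' ≐? w
  ... | yes _    | yes _    = cong (_∧ false) (resp u≐u')
  ... | no _     | no _     = cong (_∧ true) (resp u≐u')
  ... | yes u≐w  | no u'≉w = ⊥-elim (u'≉w λ v → ≡.trans (≡.sym (u≐u' v)) (u≐w v))
  ... | no u≉w   | yes u'≐w = ⊥-elim (u≉w λ v → ≡.trans (u≐u' v) (u'≐w v))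

  ∖-self : ∀ {m} (P : Exp m → Bool) w → (P ∖ w) w ≡ false
  ∖-self P w with w ≐? w
  ... | yes _   = ∧-zeroʳ (P w)
  ... | no w≉w = ⊥-elim (w≉w λ _ → refl)

  coeff-skip : ∀ {m} a {u w : Exp m} f → ¬ (u ≐ w) → coeff ((a , u) ∷ f) w ≡ coeff f w
  coeff-skip a {u} {w} f u≉w with u ≐? w
  ... | yes u≐w = ⊥-elim (u≉w u≐w)
  ... | no _    = refl

  sumCoeffs-split : ∀ {m} {P : Exp m → Bool} {w} → Respects≐ P → P w ≡ true →
    ∀ f → sumCoeffs P f ≈ coeff f w + sumCoeffs (P ∖ w) f
  sumCoeffs-split resp Pw [] = sym (+-identityˡ 0#)
  sumCoeffs-split {P = P} {w} resp Pw ((a , u) ∷ f) with u ≐? w | sumCoeffs-split resp Pw f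
  ... | yes u≐w | ih rewrite resp u≐w | Pw = trans (+-congˡ ih) (sym (+-assoc a _ _))
  ... | no _    | ih with P u
  ...   | true  = trans (+-congˡ ih) (x∙yz≈y∙xz a _ _)
  ...   | false = ih

  sumCoeffs-keep : ∀ {m} {P : Exp m → Bool} {a u} f → P u ≡ true →
    sumCoeffs P ((a , u) ∷ f) ≡ a + sumCoeffs P f
  sumCoeffs-keep f Pu rewrite Pu = refl

  sumCoeffs-skip : ∀ {m} {P : Exp m → Bool} {a u} f → P u ≡ false →
    sumCoeffs P ((a , u) ∷ f) ≡ sumCoeffs P f
  sumCoeffs-skip f Pu rewrite Pu = refl

  ∖-elim : ∀ {m} {P : Exp m → Bool} {w u} → (P ∖ w) u ≡ true → P u ≡ true × ¬ (u ≐ w)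
  ∖-elim {P = P} {w} {u} P∖wu with P u | u ≐? w
  ... | true | no u≉w = refl , u≉w

  -- Equality in K need not be decidable, and IsLeading only rules out nonzero coefficients,
  -- so vanishing is available only doubly negated.
  sumCoeffs-vanishes : ∀ {m} {P : Exp m → Bool} → Respects≐ P → ∀ f →
    (∀ u → P u ≡ true → ¬ ¬ (coeff f u ≈ 0#)) → ¬ ¬ (sumCoeffs P f ≈ 0#)
  sumCoeffs-vanishes resp [] _ = pure ≈-refl
  sumCoeffs-vanishes {P = P} resp ((a , u) ∷ f) hyp with P u in Pu
  ... | false = sumCoeffs-vanishes resp f λ u' Pu' →
          ≡.subst (λ c → ¬ ¬ (c ≈ 0#)) (coeff-skip a f (u≉ u' Pu')) (hyp u' Pu')
    where
    u≉ : ∀ u' → P u' ≡ true → ¬ (u ≐ u')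
    u≉ u' Pu' u≐u' with ≡.trans (≡.sym Pu) (≡.trans (resp u≐u') Pu')
    ... | ()
  ... | true = total <$> (hyp u Pu ⊗ rest)
    where
    rest : ¬ ¬ (sumCoeffs (P ∖ u) f ≈ 0#)
    rest = sumCoeffs-vanishes (∖-respects u resp) f λ u' P∖uu' →
      let Pu' , u'≉u = ∖-elim {P = P} P∖uu' in
      ≡.subst (λ c → ¬ ¬ (c ≈ 0#)) (coeff-skip a f (λ u≐u' → u'≉u λ v → ≡.sym (u≐u' v))) (hyp u' Pu')
    total : coeff ((a , u) ∷ f) u ≈ 0# × sumCoeffs (P ∖ u) f ≈ 0# → a + sumCoeffs P f ≈ 0#
    total (c≈0 , s≈0) = begin
      a + sumCoeffs P f                                     ≡⟨ sumCoeffs-keep f Pu ⟨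
      sumCoeffs P ((a , u) ∷ f)                             ≈⟨ sumCoeffs-split resp Pu ((a , u) ∷ f) ⟩
      coeff ((a , u) ∷ f) u + sumCoeffs (P ∖ u) ((a , u) ∷ f)
        ≡⟨ cong (_ +_) (sumCoeffs-skip f (∖-self P u)) ⟩
      coeff ((a , u) ∷ f) u + sumCoeffs (P ∖ u) f           ≈⟨ +-cong c≈0 s≈0 ⟩
      0# + 0#                                               ≈⟨ +-identityˡ 0# ⟩
      0#                                                    ∎

  inFiber : ∀ {n m} → Edges n m → (Fin n → ℤ) → ℕ → Exp m → Bool
  inFiber ends α d u = ⌊ image ends u ≗ℤ? α ⌋ ∧ ⌊ deg u ℕ.≟ d ⌋

  inFiber-respects : ∀ {n m} (ends : Edges n m) α d → Respects≐ (inFiber ends α d)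
  inFiber-respects ends α d {u} {w} u≐w = cong₂ _∧_
    (⌊⌋-cong (λ eq t → ≡.trans (≡.sym (image-cong ends u≐w t)) (eq t))
             (λ eq t → ≡.trans (image-cong ends u≐w t) (eq t))
             (image ends u ≗ℤ? α) (image ends w ≗ℤ? α))
    (⌊⌋-cong (≡.trans (≡.sym (deg-cong u≐w))) (≡.trans (deg-cong u≐w)) (deg u ℕ.≟ d) (deg w ℕ.≟ d))

  inFiber-self : ∀ {n m} (ends : Edges n m) w → inFiber ends (image ends w) (deg w) w ≡ true
  inFiber-self ends w with image ends w ≗ℤ? image ends w | deg w ℕ.≟ deg w
  ... | yes _ | yes _ = refl
  ... | no ¬p | _     = ⊥-elim (¬p λ _ → refl)
  ... | yes _ | no ¬q = ⊥-elim (¬q refl)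

  inFiber-sound : ∀ {n m} (ends : Edges n m) {w u} →
    inFiber ends (image ends w) (deg w) u ≡ true → SameFiber ends u w
  inFiber-sound ends {w} {u} P with image ends u ≗ℤ? image ends w | deg u ℕ.≟ deg w
  ... | yes p | yes q = p , q

  imageCoeff≡sumCoeffs : ∀ {n m} (ends : Edges n m) α d f →
    imageCoeff ends f α d ≡ sumCoeffs (inFiber {m = m} ends α d) f
  imageCoeff≡sumCoeffs ends α d [] = refl
  imageCoeff≡sumCoeffs ends α d ((a , u) ∷ f) with image ends u ≗ℤ? α | deg u ℕ.≟ d
  ... | yes _ | yes _ = cong (a +_) (imageCoeff≡sumCoeffs ends α d f)
  ... | yes _ | no _  = imageCoeff≡sumCoeffs ends α d f
  ... | no _  | yes _ = imageCoeff≡sumCoeffs ends α d f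
  ... | no _  | no _  = imageCoeff≡sumCoeffs ends α d f

  fiberMinimal⇒∉initialIdeal : ∀ {n m} (ends : Edges n m) (U : Exp m) →
    (∀ {w u} → w ∣ₘ U → SameFiber ends u w → ¬ u ≺ w) → ¬ InInitialIdeal ends U
  fiberMinimal⇒∉initialIdeal ends U minimal (f , f∈I , w , (cw≉0 , lead) , w∣U) =
    sumCoeffs-vanishes (∖-respects w resp) f others rest≉0
    where
    P = inFiber ends (image ends w) (deg w)
    resp = inFiber-respects ends (image ends w) (deg w)
    others : ∀ u → (P ∖ w) u ≡ true → ¬ ¬ (coeff f u ≈ 0#)
    others u P∖wu cu≉0 with ∖-elim {P = P} P∖wu | lead u cu≉0
    ... | _  , u≉w | inj₁ u≐w = u≉w u≐w
    ... | Pu , _   | inj₂ u≺w = minimal w∣U (inFiber-sound ends {w} {u} Pu) u≺w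
    rest≉0 : ¬ (sumCoeffs (P ∖ w) f ≈ 0#)
    rest≉0 rest≈0 = cw≉0 (begin
      coeff f w                            ≈⟨ +-identityʳ _ ⟨
      coeff f w + 0#                       ≈⟨ +-congˡ rest≈0 ⟨
      coeff f w + sumCoeffs (P ∖ w) f      ≈⟨ sumCoeffs-split resp (inFiber-self ends w) f ⟨
      sumCoeffs P f                        ≡⟨ imageCoeff≡sumCoeffs ends (image ends w) (deg w) f ⟨
      imageCoeff ends f (image ends w) (deg w) ≈⟨ f∈I _ _ ⟩
      0#                                   ∎)


-- Arcs, potentials and slack

δ-diagonal : ∀ {n} (b : Fin n) → δ b b ≡ ℤ.1ℤ
δ-diagonal b with b Fin.≟ b
... | yes _   = refl
... | no b≢b = ⊥-elim (b≢b refl)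

δ-offDiagonal : ∀ {n} {t b : Fin n} → t ≢ b → δ t b ≡ ℤ.0ℤ
δ-offDiagonal {t = t} {b} t≢b with t Fin.≟ b
... | yes t≡b = ⊥-elim (t≢b t≡b)
... | no _    = refl

module Arcs {n m : ℕ} (ends : Edges n m) where

  data Arc : Var m → Fin n → Fin n → Set where
    x-arc : ∀ {k a b} → ends k ≡ (a , b) → Arc (x k) a b
    y-arc : ∀ {k a b} → ends k ≡ (a , b) → Arc (y k) b a

  arc-adj : ∀ {v a b} → Arc v a b → Adj ends a b
  arc-adj (x-arc {k} e) = k , inj₁ e
  arc-adj (y-arc {k} e) = k , inj₂ e

  adj-sym : ∀ {a b} → Adj ends a b → Adj ends b a
  adj-sym (k , inj₁ e) = k , inj₂ e
  adj-sym (k , inj₂ e) = k , inj₁ e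

  joins? : ∀ k a b → Dec (Joins ends k a b)
  joins? k a b = ≡-dec Fin._≟_ Fin._≟_ (ends k) (a , b) ⊎-dec ≡-dec Fin._≟_ Fin._≟_ (ends k) (b , a)

  adj? : ∀ a b → Dec (Adj ends a b)
  adj? a b = FinP.any? λ k → joins? k a b

  joins⇒arc : ∀ {v k a b} → IsVarOf v k → Joins ends k a b → Arc v a b ⊎ Arc v b a
  joins⇒arc (inj₁ refl) (inj₁ e) = inj₁ (x-arc e)
  joins⇒arc (inj₁ refl) (inj₂ e) = inj₂ (x-arc e)
  joins⇒arc (inj₂ refl) (inj₁ e) = inj₂ (y-arc e)
  joins⇒arc (inj₂ refl) (inj₂ e) = inj₁ (y-arc e)

  module _ (simple : SimpleGraph ends) where

    same-edge : ∀ {k k' a b} → ends k ≡ (a , b) → Joins ends k' a b → k ≡ k'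
    same-edge {k} {k'} e joins =
      proj₂ simple k k' (≡.subst (λ p → Joins ends k' (proj₁ p) (proj₂ p)) (≡.sym e) joins)

    no-loop : ∀ {k a b} → ends k ≡ (a , b) → ends k ≡ (b , a) → ⊥
    no-loop {k} e e' = proj₁ simple k (≡.trans (cong proj₁ e) (≡.sym (cong proj₂ e')))

    arc-unique : ∀ {v v' a b} → Arc v a b → Arc v' a b → v ≡ v'
    arc-unique (x-arc e) (x-arc e') with same-edge e (inj₁ e')
    ... | refl = refl
    arc-unique (x-arc e) (y-arc e') with same-edge e (inj₂ e')
    ... | refl = ⊥-elim (no-loop e e')
    arc-unique (y-arc e) (x-arc e') with same-edge e (inj₂ e')
    ... | refl = ⊥-elim (no-loop e e')
    arc-unique (y-arc e) (y-arc e') with same-edge e (inj₁ e')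
    ... | refl = refl

module Potentials {n m : ℕ} (ends : Edges n m) where
  open Arcs ends
  open ≡.≡-Reasoning
  open import Data.Integer using (_+_; _*_; _-_; +_; 1ℤ; -1ℤ)
  open import Data.Integer.Tactic.RingSolver using (solve-∀)
  open import Algebra.Properties.AbelianGroup ℤP.+-0-abelianGroup using (∙-cancelˡ)

  Lipschitz : (Fin n → ℕ) → Set
  Lipschitz ψ = ∀ {a b} → Adj ends a b → ψ b ≤ suc (ψ a)

  dot : (Fin n → ℕ) → (Fin n → ℤ) → ℤ
  dot ψ α = sumFinℤ n (λ t → + ψ t * α t)

  -- slack ψ v = 1 − dot ψ (point ends v) whenever ψ is Lipschitz (dot-point+slack); the
  -- truncated subtraction is then exact.
  slack : (Fin n → ℕ) → Var m → ℕ
  slack ψ z     = 1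
  slack ψ (x k) = suc (ψ (proj₁ (ends k))) ℕ.∸ ψ (proj₂ (ends k))
  slack ψ (y k) = suc (ψ (proj₂ (ends k))) ℕ.∸ ψ (proj₁ (ends k))

  weight : (Fin n → ℕ) → Exp m → ℕ
  weight ψ u = sumVarℕ (λ v → u v ℕ.* slack ψ v)

  slack-flat : ∀ v → slack (λ _ → 0) v ≡ 1
  slack-flat z     = refl
  slack-flat (x k) = refl
  slack-flat (y k) = refl

  module _ (ψ : Fin n → ℕ) where

    slack-arc : ∀ {v a b} → Arc v a b → slack ψ v ≡ suc (ψ a) ℕ.∸ ψ b
    slack-arc (x-arc refl) = refl
    slack-arc (y-arc refl) = refl

    slack-tight : ∀ {v a b} → Arc v a b → ψ b ≡ suc (ψ a) → slack ψ v ≡ 0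
    slack-tight {a = a} arc rise =
      ≡.trans (slack-arc arc) (≡.trans (cong (suc (ψ a) ℕ.∸_) rise) (ℕP.n∸n≡0 (suc (ψ a))))

    slack-level : ∀ {v a b} → Arc v a b → ψ a ≡ ψ b → slack ψ v ≡ 1
    slack-level {b = b} arc level =
      ≡.trans (slack-arc arc) (≡.trans (cong (λ h → suc h ℕ.∸ ψ b) level) (ℕP.m+n∸n≡m 1 (ψ b)))

    slack-against : ∀ {v a b} → Arc v b a → ψ b ≡ suc (ψ a) → slack ψ v ≡ 2
    slack-against {a = a} arc rise =
      ≡.trans (slack-arc arc) (≡.trans (cong (λ h → suc h ℕ.∸ ψ a) rise) (ℕP.m+n∸n≡m 2 (ψ a)))

    dot-δ : ∀ b → dot ψ (λ t → δ t b) ≡ + ψ b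
    dot-δ b = ≡.trans
      (sumFinℤ-single n _ b λ t t≢b → ≡.trans (cong (+ ψ t *_) (δ-offDiagonal t≢b)) (ℤP.*-zeroʳ (+ ψ t)))
      (≡.trans (cong (+ ψ b *_) (δ-diagonal b)) (ℤP.*-identityʳ (+ ψ b)))

    dot-sub : ∀ α β → dot ψ (λ t → α t - β t) ≡ dot ψ α - dot ψ β
    dot-sub α β = begin
      sumFinℤ n (λ t → + ψ t * (α t - β t))
        ≡⟨ sumFinℤ-cong n (λ t → expand (+ ψ t) (α t) (β t)) ⟩
      sumFinℤ n (λ t → + ψ t * α t + -1ℤ * (+ ψ t * β t))
        ≡⟨ sumFinℤ-distrib-+ n _ _ ⟩
      dot ψ α + sumFinℤ n (λ t → -1ℤ * (+ ψ t * β t))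
        ≡⟨ cong (_+_ (dot ψ α)) (*-distribˡ-sumFinℤ n -1ℤ _) ⟨
      dot ψ α + -1ℤ * dot ψ β
        ≡⟨ cong (_+_ (dot ψ α)) (ℤP.-1*i≡-i (dot ψ β)) ⟩
      dot ψ α - dot ψ β
        ∎
      where
      expand : ∀ p a b → p * (a - b) ≡ p * a + -1ℤ * (p * b)
      expand = solve-∀

    dot-arc : ∀ {v a b} → Arc v a b → dot ψ (point ends v) ≡ + ψ b - + ψ a
    dot-arc {a = a} {b} (x-arc refl) = ≡.trans (dot-sub _ _) (cong₂ _-_ (dot-δ b) (dot-δ a))
    dot-arc {a = a} {b} (y-arc refl) = ≡.trans (dot-sub _ _) (cong₂ _-_ (dot-δ b) (dot-δ a))

    dot-image : ∀ u → dot ψ (image ends u) ≡ sumVarℤ (λ v → + u v * dot ψ (point ends v))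
    dot-image u = begin
      sumFinℤ n (λ t → + ψ t * sumVarℤ (λ v → + u v * point ends v t))
        ≡⟨ sumFinℤ-cong n (λ t → *-distribˡ-sumVarℤ (+ ψ t) λ v → + u v * point ends v t) ⟩
      sumFinℤ n (λ t → sumVarℤ (λ v → + ψ t * (+ u v * point ends v t)))
        ≡⟨ sumFinℤ-sumVarℤ-comm n (λ v t → + ψ t * (+ u v * point ends v t)) ⟩
      sumVarℤ (λ v → sumFinℤ n (λ t → + ψ t * (+ u v * point ends v t)))
        ≡⟨ sumVarℤ-cong (λ v → sumFinℤ-cong n λ t → swap (+ ψ t) (+ u v) (point ends v t)) ⟩
      sumVarℤ (λ v → sumFinℤ n (λ t → + u v * (+ ψ t * point ends v t)))
        ≡⟨ sumVarℤ-cong (λ v → *-distribˡ-sumFinℤ n (+ u v) λ t → + ψ t * point ends v t) ⟨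
      sumVarℤ (λ v → + u v * dot ψ (point ends v))
        ∎
      where
      swap : ∀ p q r → p * (q * r) ≡ q * (p * r)
      swap = solve-∀

    weight-+ : ∀ a b → weight ψ (λ v → a v ℕ.+ b v) ≡ weight ψ a ℕ.+ weight ψ b
    weight-+ a b = ≡.trans (sumVarℕ-cong λ v → ℕP.*-distribʳ-+ (slack ψ v) (a v) (b v))
                           (sumVarℕ-distrib-+ (λ v → a v ℕ.* slack ψ v) (λ v → b v ℕ.* slack ψ v))

    weight-split : ∀ a b → weight ψ b ≡ weight ψ (a ⊓ₑ b) ℕ.+ weight ψ (b ∸ₑ a)
    weight-split a b =
      ≡.trans (sumVarℕ-cong λ v → cong (ℕ._* slack ψ v) (≡.sym (ℕP.m⊓n+n∸m≡n (a v) (b v))))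
              (weight-+ (a ⊓ₑ b) (b ∸ₑ a))

    weight-⊓-comm : ∀ a b → weight ψ (a ⊓ₑ b) ≡ weight ψ (b ⊓ₑ a)
    weight-⊓-comm a b = sumVarℕ-cong λ v → cong (ℕ._* slack ψ v) (ℕP.⊓-comm (a v) (b v))

    module _ (lip : Lipschitz ψ) where

      arc-balance : ∀ {v a b} → Arc v a b → dot ψ (point ends v) + + slack ψ v ≡ 1ℤ
      arc-balance {v} {a} {b} arc = begin
        dot ψ (point ends v) + + slack ψ v
          ≡⟨ cong₂ _+_ (dot-arc arc) (cong +_ (slack-arc arc)) ⟩
        (+ ψ b - + ψ a) + + (suc (ψ a) ℕ.∸ ψ b)
          ≡⟨ cong (_+_ (+ ψ b - + ψ a)) (+-∸ (lip (arc-adj arc))) ⟩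
        (+ ψ b - + ψ a) + (1ℤ + + ψ a - + ψ b)
          ≡⟨ telescope (+ ψ a) (+ ψ b) ⟩
        1ℤ
          ∎
        where
        +-∸ : ∀ {p q} → q ≤ p → + (p ℕ.∸ q) ≡ + p - + q
        +-∸ {p} {q} q≤p = ≡.sym (≡.trans (ℤP.m-n≡m⊖n p q) (ℤP.⊖-≥ q≤p))
        telescope : ∀ p q → (q - p) + (1ℤ + p - q) ≡ 1ℤ
        telescope = solve-∀

      dot-point+slack : ∀ v → dot ψ (point ends v) + + slack ψ v ≡ 1ℤ
      dot-point+slack z     =
        cong (_+ 1ℤ) (≡.trans (sumFinℤ-cong n λ t → ℤP.*-zeroʳ (+ ψ t)) (sumFinℤ-zero n))
      dot-point+slack (x k) = arc-balance (x-arc refl)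
      dot-point+slack (y k) = arc-balance (y-arc refl)

      deg≡dot+weight : ∀ u → + deg u ≡ dot ψ (image ends u) + + weight ψ u
      deg≡dot+weight u = begin
        + deg u
          ≡⟨ +-sumVarℕ u ⟩
        sumVarℤ (λ v → + u v)
          ≡⟨ sumVarℤ-cong split ⟩
        sumVarℤ (λ v → + u v * dot ψ (point ends v) + + (u v ℕ.* slack ψ v))
          ≡⟨ sumVarℤ-distrib-+ (λ v → + u v * dot ψ (point ends v)) (λ v → + (u v ℕ.* slack ψ v)) ⟩
        sumVarℤ (λ v → + u v * dot ψ (point ends v)) + sumVarℤ (λ v → + (u v ℕ.* slack ψ v))
          ≡⟨ cong₂ _+_ (dot-image u) (+-sumVarℕ λ v → u v ℕ.* slack ψ v) ⟨
        dot ψ (image ends u) + + weight ψ u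
          ∎
        where
        split : ∀ v → + u v ≡ + u v * dot ψ (point ends v) + + (u v ℕ.* slack ψ v)
        split v = begin
          + u v                                                ≡⟨ ℤP.*-identityʳ (+ u v) ⟨
          + u v * 1ℤ                                           ≡⟨ cong (+ u v *_) (dot-point+slack v) ⟨
          + u v * (dot ψ (point ends v) + + slack ψ v)         ≡⟨ ℤP.*-distribˡ-+ (+ u v) _ _ ⟩
          + u v * dot ψ (point ends v) + + u v * + slack ψ v
            ≡⟨ cong (_+_ (+ u v * dot ψ (point ends v))) (ℤP.pos-* (u v) (slack ψ v)) ⟨
          + u v * dot ψ (point ends v) + + (u v ℕ.* slack ψ v) ∎

      weight-fiber : ∀ {u w} → SameFiber ends u w → weight ψ u ≡ weight ψ w
      weight-fiber {u} {w} (image≡ , deg≡) =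
        ℤP.+-injective (∙-cancelˡ (dot ψ (image ends w)) _ _ (begin
        dot ψ (image ends w) + + weight ψ u  ≡⟨ cong (_+ + weight ψ u) dot≡ ⟨
        dot ψ (image ends u) + + weight ψ u  ≡⟨ deg≡dot+weight u ⟨
        + deg u                              ≡⟨ cong +_ deg≡ ⟩
        + deg w                              ≡⟨ deg≡dot+weight w ⟩
        dot ψ (image ends w) + + weight ψ w  ∎))
        where
        dot≡ : dot ψ (image ends u) ≡ dot ψ (image ends w)
        dot≡ = sumFinℤ-cong n λ t → cong (+ ψ t *_) (image≡ t)

      deficit-slack≡0⇒surplus-slack≡0 : ∀ {u w} → SameFiber ends u w →
        (∀ v → u v < w v → slack ψ v ≡ 0) → ∀ {v₀} → w v₀ < u v₀ → slack ψ v₀ ≡ 0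
      deficit-slack≡0⇒surplus-slack≡0 {u} {w} fiber tight {v₀} w<u
        with ℕP.m*n≡0⇒m≡0∨n≡0 (u v₀ ℕ.∸ w v₀) term≡0
        where
        deficit≡0 : weight ψ (w ∸ₑ u) ≡ 0
        deficit≡0 = sumVarℕ-zero (λ v → (w ∸ₑ u) v ℕ.* slack ψ v) term≡0
          where
          term≡0 : ∀ v → (w v ℕ.∸ u v) ℕ.* slack ψ v ≡ 0
          term≡0 v with u v ℕ.<? w v
          ... | yes u<w =
            ≡.trans (cong (ℕ._*_ (w v ℕ.∸ u v)) (tight v u<w)) (ℕP.*-zeroʳ (w v ℕ.∸ u v))
          ... | no u≮w  = cong (ℕ._* slack ψ v) (ℕP.m≤n⇒m∸n≡0 (ℕP.≮⇒≥ u≮w))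
        surplus≡0 : weight ψ (u ∸ₑ w) ≡ 0
        surplus≡0 = ℕP.+-cancelˡ-≡ (weight ψ (u ⊓ₑ w)) _ _ (begin
          weight ψ (u ⊓ₑ w) ℕ.+ weight ψ (u ∸ₑ w)
            ≡⟨ cong (ℕ._+ weight ψ (u ∸ₑ w)) (weight-⊓-comm u w) ⟩
          weight ψ (w ⊓ₑ u) ℕ.+ weight ψ (u ∸ₑ w) ≡⟨ weight-split w u ⟨
          weight ψ u                               ≡⟨ weight-fiber {u} {w} fiber ⟩
          weight ψ w                               ≡⟨ weight-split u w ⟩
          weight ψ (u ⊓ₑ w) ℕ.+ weight ψ (w ∸ₑ u) ≡⟨ cong (weight ψ (u ⊓ₑ w) ℕ.+_) deficit≡0 ⟩
          weight ψ (u ⊓ₑ w) ℕ.+ 0                  ∎)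
        term≡0 : (u v₀ ℕ.∸ w v₀) ℕ.* slack ψ v₀ ≡ 0
        term≡0 = ℕP.n≤0⇒n≡0 (≡.subst ((u v₀ ℕ.∸ w v₀) ℕ.* slack ψ v₀ ≤_) surplus≡0
                              (term≤sumVarℕ (λ v → (u ∸ₑ w) v ℕ.* slack ψ v) v₀))
      ... | inj₁ surplus≡0 = ⊥-elim (ℕP.<⇒≢ (ℕP.m<n⇒0<n∸m w<u) (≡.sym surplus≡0))
      ... | inj₂ slack≡0   = slack≡0

-- Walks and the Lipschitz extension

module Walks {n m : ℕ} (ends : Edges n m) where
  open Arcs ends using (adj-sym; adj?)
  open Potentials ends using (Lipschitz)
  open import Data.Nat using (_+_; _∸_)

  data Walk : ℕ → Fin n → Fin n → Set where
    []  : ∀ {a} → Walk 0 a a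
    _∷_ : ∀ {ℓ a b c} → Adj ends a b → Walk ℓ b c → Walk (suc ℓ) a c

  walk? : ∀ ℓ a c → Dec (Walk ℓ a c)
  walk? zero    a c = map′ (λ { refl → [] }) (λ { [] → refl }) (a Fin.≟ c)
  walk? (suc ℓ) a c = map′ (λ (b , e , w) → e ∷ w) (λ { (e ∷ w) → _ , e , w })
                          (FinP.any? λ b → adj? a b ×-dec walk? ℓ b c)

  _++_ : ∀ {ℓ ℓ' a b c} → Walk ℓ a b → Walk ℓ' b c → Walk (ℓ + ℓ') a c
  []      ++ w' = w'
  (e ∷ w) ++ w' = e ∷ (w ++ w')

  _∷ʳ_ : ∀ {ℓ a b c} → Walk ℓ a b → Adj ends b c → Walk (suc ℓ) a c
  []      ∷ʳ e' = e' ∷ []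
  (e ∷ w) ∷ʳ e' = e ∷ (w ∷ʳ e')

  reverse : ∀ {ℓ a b} → Walk ℓ a b → Walk ℓ b a
  reverse []      = []
  reverse (e ∷ w) = reverse w ∷ʳ adj-sym e

  vertex : ∀ {ℓ a b} → Walk ℓ a b → Fin (suc ℓ) → Fin n
  vertex {a = a} w       zero    = a
  vertex         (e ∷ w) (suc t) = vertex w t

  IsPath : ∀ {ℓ a b} → Walk ℓ a b → Set
  IsPath []                  = ⊤
  IsPath (_∷_ {a = a} e w) = (∀ t → vertex w t ≢ a) × IsPath w

  suffix : ∀ {ℓ a c} (w : Walk ℓ a c) (t : Fin (suc ℓ)) → Walk (ℓ ∸ toℕ t) (vertex w t) c
  suffix w       zero    = w
  suffix (e ∷ w) (suc t) = suffix w t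

  suffix-isPath : ∀ {ℓ a c} (w : Walk ℓ a c) t → IsPath w → IsPath (suffix w t)
  suffix-isPath w       zero    path       = path
  suffix-isPath (e ∷ w) (suc t) (_ , path) = suffix-isPath w t path

  shorten : ∀ {ℓ a c} → Walk ℓ a c → ∃[ ℓ' ] (ℓ' ≤ ℓ × Σ (Walk ℓ' a c) IsPath)
  shorten []                = 0 , ℕ.z≤n , [] , tt
  shorten {a = a} (e ∷ w) with shorten w
  ... | ℓ' , ℓ'≤ℓ , p , path with FinP.any? (λ t → vertex p t Fin.≟ a)
  ...   | yes (t , p[t]≡a) =
    ℓ' ∸ toℕ t , ℕP.≤-trans (ℕP.m∸n≤m ℓ' (toℕ t)) (ℕP.m≤n⇒m≤1+n ℓ'≤ℓ) ,
    ≡.subst (λ b → Σ (Walk (ℓ' ∸ toℕ t) b _) IsPath) p[t]≡a (suffix p t , suffix-isPath p t path)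
  ...   | no a∉p           = suc ℓ' , ℕ.s≤s ℓ'≤ℓ , e ∷ p , (λ t p[t]≡a → a∉p (t , p[t]≡a)) , path

  vertex-last : ∀ {ℓ a c} (w : Walk ℓ a c) → vertex w (fromℕ ℓ) ≡ c
  vertex-last []      = refl
  vertex-last (e ∷ w) = vertex-last w

  vertex-isWalk : ∀ {ℓ a c} (w : Walk ℓ a c) → IsWalk ends ℓ (vertex w)
  vertex-isWalk (e ∷ w) zero    = e
  vertex-isWalk (e ∷ w) (suc t) = vertex-isWalk w t

  vertex-injective : ∀ {ℓ a c} (w : Walk ℓ a c) → IsPath w → ∀ s t → vertex w s ≡ vertex w t → s ≡ t
  vertex-injective w       _            zero    zero    _  = refl
  vertex-injective (e ∷ w) (fresh , _)  zero    (suc t) eq = ⊥-elim (fresh t (≡.sym eq))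
  vertex-injective (e ∷ w) (fresh , _)  (suc s) zero    eq = ⊥-elim (fresh s eq)
  vertex-injective (e ∷ w) (_ , path)   (suc s) (suc t) eq = cong suc (vertex-injective w path s t eq)

  path⇒PathFromTo : ∀ {ℓ a c} (w : Walk ℓ a c) → IsPath w → PathFromTo ends a c ℓ (vertex w)
  path⇒PathFromTo w path = (vertex-isWalk w , refl , vertex-last w) , vertex-injective w path

  prefixWalk : ∀ {L p} → IsWalk ends L p → (t : Fin (suc L)) → Walk (toℕ t) (p zero) (p t)
  prefixWalk         W zero    = []
  prefixWalk {suc L} {p} W (suc t) = W zero ∷ prefixWalk {p = p ∘ suc} (W ∘ suc) t

  suffixWalk : ∀ {L p} → IsWalk ends L p → (t : Fin (suc L)) → Walk (L ∸ toℕ t) (p t) (p (fromℕ L))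
  suffixWalk {zero}  W zero    = []
  suffixWalk {suc L} {p} W zero    = W zero ∷ suffixWalk {p = p ∘ suc} (W ∘ suc) zero
  suffixWalk {suc L} {p} W (suc t) = suffixWalk {p = p ∘ suc} (W ∘ suc) t

  module Geodesic {i j L γ} (sp : ShortestPath ends i j L γ) where

    γ-isWalk : IsWalk ends L γ
    γ-isWalk = proj₁ (proj₁ (proj₁ sp))

    γ-start : γ zero ≡ i
    γ-start = proj₁ (proj₂ (proj₁ (proj₁ sp)))

    γ-end : γ (fromℕ L) ≡ j
    γ-end = proj₂ (proj₂ (proj₁ (proj₁ sp)))

    L≤length : ∀ {ℓ} → Walk ℓ i j → L ≤ ℓ
    L≤length w with shorten w
    ... | ℓ' , ℓ'≤ℓ , p , path = ℕP.≤-trans (proj₂ sp ℓ' (vertex p) (path⇒PathFromTo p path)) ℓ'≤ℓ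

    index≤ : ∀ {d} s t → Walk d (γ s) (γ t) → toℕ t ≤ toℕ s + d
    index≤ {d} s t w = ℕP.+-cancelʳ-≤ (L ∸ toℕ t) (toℕ t) (toℕ s + d) (begin
      toℕ t + (L ∸ toℕ t)       ≡⟨ ℕP.m+[n∸m]≡n (FinP.toℕ≤pred[n] t) ⟩
      L                         ≤⟨ L≤length (≡.subst₂ (Walk _) γ-start γ-end through) ⟩
      toℕ s + (d + (L ∸ toℕ t)) ≡⟨ ℕP.+-assoc (toℕ s) d _ ⟨
      toℕ s + d + (L ∸ toℕ t)   ∎)
      where
      open ℕP.≤-Reasoning
      through : Walk (toℕ s + (d + (L ∸ toℕ t))) (γ zero) (γ (fromℕ L))
      through = prefixWalk γ-isWalk s ++ (w ++ suffixWalk γ-isWalk t)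

    ∣index∣≤length : ∀ {d} s t → Walk d (γ s) (γ t) → ∣ toℕ s - toℕ t ∣ ≤ d
    ∣index∣≤length s t w =
      m≤n+o∧n≤m+o⇒∣m-n∣≤o (toℕ s) (toℕ t) (index≤ t s (reverse w)) (index≤ s t w)

  -- ψ c = min (cap , min_t (F t + d(c , γ t))), the McShane extension of F; it agrees with F
  -- on γ because distances along the shortest path γ are distances in G.
  module LipschitzExtension {i j L γ} (sp : ShortestPath ends i j L γ) (F : Fin (suc L) → ℕ)
                   (F-lipschitz : ∀ s t → ∣ F s - F t ∣ ≤ ∣ toℕ s - toℕ t ∣) where
    open Geodesic sp

    cap : ℕ
    cap = F zero + L

    F≤cap : ∀ t → F t ≤ cap
    F≤cap t = ℕP.≤-trans (ℕP.m≤n+∣m-n∣ (F t) (F zero))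
      (ℕP.+-monoʳ-≤ (F zero) (ℕP.≤-trans (F-lipschitz t zero)
        (≡.subst (_≤ L) (≡.sym (ℕP.∣-∣-identityʳ (toℕ t))) (FinP.toℕ≤pred[n] t))))

    Reaches : Fin n → ℕ → Set
    Reaches c h = h ≡ cap ⊎ ∃[ t ] (F t ≤ h × Walk (h ∸ F t) c (γ t))

    reaches? : ∀ c h → Dec (Reaches c h)
    reaches? c h = (h ℕ.≟ cap) ⊎-dec FinP.any? λ t → (F t ℕ.≤? h) ×-dec walk? (h ∸ F t) c (γ t)

    minimalReach : ∀ c → ∃[ h ] (Reaches c h × (∀ {h'} → Reaches c h' → h ≤ h'))
    minimalReach c = least (reaches? c) (inj₁ refl)

    ψ : Fin n → ℕ
    ψ c = proj₁ (minimalReach c)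

    ψ-reaches : ∀ c → Reaches c (ψ c)
    ψ-reaches c = proj₁ (proj₂ (minimalReach c))

    ψ-minimal : ∀ {c h} → Reaches c h → ψ c ≤ h
    ψ-minimal {c} = proj₂ (proj₂ (minimalReach c))

    ψ-extends : ∀ t → ψ (γ t) ≡ F t
    ψ-extends t = ℕP.≤-antisym (ψ-minimal (inj₂ (t , ℕP.≤-refl , stay))) (F≤ψ (ψ-reaches (γ t)))
      where
      stay : Walk (F t ∸ F t) (γ t) (γ t)
      stay = ≡.subst (λ d → Walk d (γ t) (γ t)) (≡.sym (ℕP.n∸n≡0 (F t))) []
      F≤ψ : ∀ {h} → Reaches (γ t) h → F t ≤ h
      F≤ψ (inj₁ refl)              = F≤cap t
      F≤ψ {h} (inj₂ (t' , F≤h , w)) = begin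
        F t                            ≤⟨ ℕP.m≤n+∣m-n∣ (F t) (F t') ⟩
        F t' + ∣ F t - F t' ∣          ≤⟨ ℕP.+-monoʳ-≤ (F t') (F-lipschitz t t') ⟩
        F t' + ∣ toℕ t - toℕ t' ∣      ≤⟨ ℕP.+-monoʳ-≤ (F t') (∣index∣≤length t t' w) ⟩
        F t' + (h ∸ F t')              ≡⟨ ℕP.m+[n∸m]≡n F≤h ⟩
        h                              ∎
        where open ℕP.≤-Reasoning

    ψ-lipschitz : Lipschitz ψ
    ψ-lipschitz {a} {b} a~b with ψ-reaches a
    ... | inj₁ ψa≡cap =
      ℕP.m≤n⇒m≤1+n (≡.subst (ψ b ≤_) (≡.sym ψa≡cap) (ψ-minimal (inj₁ refl)))
    ... | inj₂ (t , F≤ψa , w) = ψ-minimal (inj₂ (t , ℕP.m≤n⇒m≤1+n F≤ψa ,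
      ≡.subst (λ d → Walk d b (γ t)) (≡.sym (ℕP.+-∸-assoc 1 F≤ψa)) (adj-sym a~b ∷ w)))

-- Height profiles along the path

data Step : Set where
  up flat down : Step

Follows : Step → ℕ → ℕ → Set
Follows up   a b = b ≡ suc a
Follows flat a b = b ≡ a
Follows down a b = a ≡ suc b

ups downs : Step → ℕ
ups up = 1
ups _  = 0
downs down = 1
downs _    = 0

-- profile s t = (ups before t) + (downs from t on), so it moves by s t at step t and never
-- needs a truncated subtraction.
profile : ∀ {L} → (Fin L → Step) → Fin (suc L) → ℕ
profile {zero}  s zero    = 0
profile {suc L} s zero    = downs (s zero) ℕ.+ profile (s ∘ suc) zero
profile {suc L} s (suc t) = ups (s zero) ℕ.+ profile (s ∘ suc) t

follows-offset : ∀ st a → Follows st (downs st ℕ.+ a) (ups st ℕ.+ a)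
follows-offset up   a = refl
follows-offset flat a = refl
follows-offset down a = refl

follows-shift : ∀ {st a b} c → Follows st a b → Follows st (c ℕ.+ a) (c ℕ.+ b)
follows-shift {up}   {a} c refl = ℕP.+-suc c a
follows-shift {flat}     c refl = refl
follows-shift {down} {b = b} c refl = ℕP.+-suc c b

profile-follows : ∀ {L} (s : Fin L → Step) t → Follows (s t) (profile s (inject₁ t)) (profile s (suc t))
profile-follows {suc L} s zero    = follows-offset (s zero) (profile (s ∘ suc) zero)
profile-follows {suc L} s (suc t) = follows-shift (ups (s zero)) (profile-follows (s ∘ suc) t)

∣n-1+n∣≡1 : ∀ n → ∣ n - suc n ∣ ≡ 1
∣n-1+n∣≡1 zero    = refl
∣n-1+n∣≡1 (suc n) = ∣n-1+n∣≡1 n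

follows⇒∣-∣≤1 : ∀ {st a b} → Follows st a b → ∣ a - b ∣ ≤ 1
follows⇒∣-∣≤1 {up}   {a}     refl = ℕP.≤-reflexive (∣n-1+n∣≡1 a)
follows⇒∣-∣≤1 {flat} {a}     refl = ℕP.≤-trans (ℕP.≤-reflexive (ℕP.∣n-n∣≡0 a)) ℕ.z≤n
follows⇒∣-∣≤1 {down} {b = b} refl = ℕP.≤-reflexive (≡.trans (ℕP.∣-∣-comm (suc b) b) (∣n-1+n∣≡1 b))

stepwise-from-zero : ∀ {L} (f : Fin (suc L) → ℕ) → (∀ t → ∣ f (inject₁ t) - f (suc t) ∣ ≤ 1) →
  ∀ t → ∣ f zero - f t ∣ ≤ toℕ t
stepwise-from-zero         f step zero    = ℕP.≤-reflexive (ℕP.∣n-n∣≡0 (f zero))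
stepwise-from-zero {suc L} f step (suc t) = begin
  ∣ f zero - f (suc t) ∣
    ≤⟨ ℕP.∣-∣-triangle (f zero) (f (suc zero)) (f (suc t)) ⟩
  ∣ f zero - f (suc zero) ∣ ℕ.+ ∣ f (suc zero) - f (suc t) ∣
    ≤⟨ ℕP.+-mono-≤ (step zero) (stepwise-from-zero (f ∘ suc) (step ∘ suc) t) ⟩
  suc (toℕ t)
    ∎
  where open ℕP.≤-Reasoning

stepwise-lipschitz : ∀ {L} (f : Fin (suc L) → ℕ) → (∀ t → ∣ f (inject₁ t) - f (suc t) ∣ ≤ 1) →
  ∀ s t → ∣ f s - f t ∣ ≤ ∣ toℕ s - toℕ t ∣
stepwise-lipschitz         f step zero    t       = stepwise-from-zero f step t
stepwise-lipschitz         f step (suc s) zero    =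
  ≡.subst (_≤ suc (toℕ s)) (ℕP.∣-∣-comm (f zero) (f (suc s))) (stepwise-from-zero f step (suc s))
stepwise-lipschitz {suc L} f step (suc s) (suc t) = stepwise-lipschitz (f ∘ suc) (step ∘ suc) s t

profile-lipschitz : ∀ {L} (s : Fin L → Step) a b → ∣ profile s a - profile s b ∣ ≤ ∣ toℕ a - toℕ b ∣
profile-lipschitz s = stepwise-lipschitz (profile s) λ t → follows⇒∣-∣≤1 (profile-follows s t)

stepOf : ∀ {p q r} {P : Set p} {X : Set q} {Y : Set r} → Dec P → X ⊎ Y → Step
stepOf (no _)  _        = flat
stepOf (yes _) (inj₁ _) = up
stepOf (yes _) (inj₂ _) = down

stepOf-level : ∀ {p q r} {P : Set p} {X : Set q} {Y : Set r} (d : Dec P) (o : X ⊎ Y) {a b} →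
  ¬ P → Follows (stepOf d o) a b → a ≡ b
stepOf-level (yes p) _ ¬p _  = ⊥-elim (¬p p)
stepOf-level (no _)  _ _  eq = ≡.sym eq

stepOf-rise : ∀ {p q r} {P : Set p} {X : Set q} {Y : Set r} (d : Dec P) (o : X ⊎ Y) {a b} →
  P → Follows (stepOf d o) a b → (X × b ≡ suc a) ⊎ (Y × a ≡ suc b)
stepOf-rise (no ¬p) _        p _  = ⊥-elim (¬p p)
stepOf-rise (yes _) (inj₁ l) _ eq = inj₁ (l , eq)
stepOf-rise (yes _) (inj₂ r) _ eq = inj₂ (r , eq)

ZOrPathVar OffPathVar : ∀ {n m} → Edges n m → (L : ℕ) → (Fin (suc L) → Fin n) → Var m → Set
ZOrPathVar ends L γ v = v ≡ z ⊎ ∃[ k ] (IsVarOf v k × OnPath ends L γ k)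
OffPathVar ends L γ v = ∃[ k ] (IsVarOf v k × ¬ OnPath ends L γ k)

module PathPotential {n m} {ends : Edges n m} (simple : SimpleGraph ends)
                     {i j L γ} (sp : ShortestPath ends i j L γ)
                     {σ : Fin L → Var m} (ori : IsOrientation ends L γ σ)
                     {D : Var m → Set} (D? : ∀ v → Dec (D v)) (D⊆σ : ∀ {v} → D v → ∃[ t ] σ t ≡ v) where
  open Arcs ends
  open Potentials ends

  direction : ∀ t → Arc (σ t) (γ (inject₁ t)) (γ (suc t)) ⊎ Arc (σ t) (γ (suc t)) (γ (inject₁ t))
  direction t = let _ , isVar , joins = ori t in joins⇒arc isVar joins

  slope : Fin L → Step
  slope t = stepOf (D? (σ t)) (direction t)

  open Walks.LipschitzExtension ends sp (profile slope) (profile-lipschitz slope) public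
    using (ψ; ψ-lipschitz)
  open Walks.LipschitzExtension ends sp (profile slope) (profile-lipschitz slope)
    using (ψ-extends)

  ψ-follows : ∀ t → Follows (slope t) (ψ (γ (inject₁ t))) (ψ (γ (suc t)))
  ψ-follows t = ≡.subst₂ (Follows (slope t)) (≡.sym (ψ-extends (inject₁ t))) (≡.sym (ψ-extends (suc t)))
                         (profile-follows slope t)

  deficit-slack≡0 : ∀ {v} → D v → slack ψ v ≡ 0
  deficit-slack≡0 d with D⊆σ d
  ... | t , refl with stepOf-rise (D? (σ t)) (direction t) d (ψ-follows t)
  ...   | inj₁ (arc , rise) = slack-tight ψ arc rise
  ...   | inj₂ (arc , rise) = slack-tight ψ arc rise

  slack-other-orientation : ∀ {v v' a b} → ¬ D v → D v' → Arc v' a b → ψ b ≡ suc (ψ a) →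
    Arc v a b ⊎ Arc v b a → 1 ≤ slack ψ v
  slack-other-orientation ¬Dv Dv' arc' rise (inj₁ arc) =
    ⊥-elim (¬Dv (≡.subst D (arc-unique simple arc' arc) Dv'))
  slack-other-orientation ¬Dv Dv' arc' rise (inj₂ arc) =
    ≡.subst (1 ≤_) (≡.sym (slack-against ψ arc rise)) (ℕ.s≤s ℕ.z≤n)

  slack-positive : ∀ {v₀} → ¬ D v₀ → ZOrPathVar ends L γ v₀ → 1 ≤ slack ψ v₀
  slack-positive ¬D₀ (inj₁ refl) = ℕP.≤-refl
  slack-positive {v₀} ¬D₀ (inj₂ (k , isVar , t , joins)) with D? (σ t)
  ... | no ¬D = ≡.subst (1 ≤_) (≡.sym (level (joins⇒arc isVar joins))) ℕP.≤-refl
    where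
    flat-edge : ψ (γ (inject₁ t)) ≡ ψ (γ (suc t))
    flat-edge = stepOf-level (D? (σ t)) (direction t) ¬D (ψ-follows t)
    level : Arc v₀ (γ (inject₁ t)) (γ (suc t)) ⊎ Arc v₀ (γ (suc t)) (γ (inject₁ t)) → slack ψ v₀ ≡ 1
    level (inj₁ arc) = slack-level ψ arc flat-edge
    level (inj₂ arc) = slack-level ψ arc (≡.sym flat-edge)
  ... | yes d with stepOf-rise (D? (σ t)) (direction t) d (ψ-follows t)
  ...   | inj₁ (arc , rise) = slack-other-orientation ¬D₀ d arc rise (joins⇒arc isVar joins)
  ...   | inj₂ (arc , rise) = slack-other-orientation ¬D₀ d arc rise (Sum.swap (joins⇒arc isVar joins))

-- The path monomial

module _ {n m} {ends : Edges n m} (simple : SimpleGraph ends) {i j L γ} (sp : ShortestPath ends i j L γ)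
         (pathEdgesFirst : ∀ k k' → OnPath ends L γ k → ¬ OnPath ends L γ k' → k Fin.< k')
         {σ : Fin L → Var m} (ori : IsOrientation ends L γ σ) where
  open Arcs ends using (joins?)
  open Potentials ends

  onPath? : ∀ k → Dec (OnPath ends L γ k)
  onPath? k = FinP.any? λ t → joins? k (γ (inject₁ t)) (γ (suc t))

  classifyEdge : ∀ k {v} → IsVarOf v k → ZOrPathVar ends L γ v ⊎ OffPathVar ends L γ v
  classifyEdge k isVar with onPath? k
  ... | yes on  = inj₁ (inj₂ (k , isVar , on))
  ... | no  off = inj₂ (k , isVar , off)

  classify : ∀ v → ZOrPathVar ends L γ v ⊎ OffPathVar ends L γ v
  classify z     = inj₁ (inj₁ refl)
  classify (x k) = classifyEdge k (inj₁ refl)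
  classify (y k) = classifyEdge k (inj₂ refl)

  deficit⊆path : ∀ {w u : Exp m} {v} → w ∣ₘ monomialOf L σ → u v < w v → ∃[ t ] σ t ≡ v
  deficit⊆path {v = v} w∣U u<w =
    monomialOf-support L σ v (ℕP.<-≤-trans (ℕP.≤-<-trans ℕ.z≤n u<w) (w∣U v))

  pathMonomial-fiberMinimal : ∀ {w u} → w ∣ₘ monomialOf L σ → SameFiber ends u w → ¬ u ≺ w
  pathMonomial-fiberMinimal w∣U (_ , deg≡) (inj₁ deg<) = ℕP.<-irrefl deg≡ deg<
  pathMonomial-fiberMinimal {w} {u} w∣U fiber (inj₂ (_ , v₀ , w<u , agree)) with classify v₀
  ... | inj₁ onPath = ℕP.<⇒≢ (slack-positive (ℕP.<-asym w<u) onPath) (≡.sym surplus-slack≡0)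
    where
    open PathPotential simple sp ori {λ v → u v < w v} (λ v → u v ℕ.<? w v) (deficit⊆path {w} {u} w∣U)
    surplus-slack≡0 : slack ψ v₀ ≡ 0
    surplus-slack≡0 =
      deficit-slack≡0⇒surplus-slack≡0 ψ ψ-lipschitz {u} {w} fiber (λ v → deficit-slack≡0 {v}) w<u
  ... | inj₂ (k , isVar , off) = ℕP.1+n≢0 (≡.trans (≡.sym (slack-flat v₀)) surplus-slack≡0)
    where
    no-deficit : ∀ {v} → u v < w v → ⊥
    no-deficit u<w with deficit⊆path {w} {u} w∣U u<w
    ... | t , refl = let k' , isVar' , joins = ori t in
      ℕP.<-irrefl (≡.sym (agree (σ t) (rank-mono (pathEdgesFirst k' k (t , joins) off) isVar' isVar))) u<w
    surplus-slack≡0 : slack (λ _ → 0) v₀ ≡ 0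
    surplus-slack≡0 = deficit-slack≡0⇒surplus-slack≡0 (λ _ → 0) (λ _ → ℕ.z≤n) {u} {w} fiber
                        (λ v u<w → ⊥-elim (no-deficit {v} u<w)) w<u

proposition5p9 : ∀ {c ℓ} (K : Field c ℓ) (n m : ℕ) (ends : Edges n m) →
    SimpleGraph ends → TwoConnected ends →
    (i j : Fin n) → i ≢ j →
    (L : ℕ) (γ : Fin (suc L) → Fin n) → ShortestPath ends i j L γ →
    (∀ k k' → OnPath ends L γ k → ¬ OnPath ends L γ k' → k Fin.< k') →
    (σ : Fin L → Var m) → IsOrientation ends L γ σ →
    SpansFace K ends L σ
proposition5p9 K n m ends simple _ i j _ L γ sp pathEdgesFirst σ ori =
  InitialIdeal.fiberMinimal⇒∉initialIdeal K ends (monomialOf L σ)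
    (pathMonomial-fiberMinimal simple sp pathEdgesFirst ori)
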